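{- Let $\mathbb{G}$ be a strongly connected finite reflexive digraph and let $f:\mathbb{G}^n \rightarrow \mathbb{G}$ be a surjective polymorphism with $n\geq 2$. Suppose $\mathbb{G}$ is idempotent trivial and the identity is alone in its strong component of $Hom(\mathbb{G},\mathbb{G})$. If there exists an embedding $e:\mathbb{G} \hookrightarrow \mathbb{G}^n$ such that the restriction of $f$ to $e(\mathbb{G})$ is onto $G$, then $f$ is essentially unary.
   Context: All digraphs are finite and reflexive. A digraph is strongly connected if for any two vertices $x,y$ there are directed walks from $x$ to $y$ and from $y$ to $x$; strong components are the classes of this relation. An embedding is a homomorphism that is an isomorphism onto an induced subdigraph. A polymorphism $f:\mathbb{G}^n\to\mathbb{G}$ is a homomorphism from the product digraph; it is idempotent if $f(x,\dots,x)=x$, essentially unary if $f(x_1,\dots,x_n)=g(x_i)$ for some $i$ and homomorphism $g:\mathbb{G}\to\mathbb{G}$, a projection if moreover $g$ is the identity. $\mathbb{G}$ is idempotent trivial if for all $k\ge2$ every idempotent $k$-ary polymorphism is a projection. $Hom(\mathbb{G},\mathbb{G})$ has the endomorphisms as vertices and an arc $(f,g)$ iff $(f(x),g(y))$ is an arc whenever $(x,y)$ is. -}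

module Defs where

open import Data.Nat using (ℕ; _≥_)
open import Data.Fin using (Fin)
open import Data.Product using (Σ; ∃; _×_; _,_; proj₁)
open import Relation.Binary.PropositionalEquality using (_≡_)
open import Relation.Binary.Definitions using (Decidable)
open import Relation.Binary.Construct.Closure.ReflexiveTransitive using (Star)

-- A finite reflexive digraph: vertex set Fin size, arc relation Arc
-- (decidable, as any relation on a finite set is classically).
record Digraph : Set₁ where
  field
    size  : ℕ
    Arc   : Fin size → Fin size → Set
    Arc?  : Decidable Arc
    refl  : ∀ x → Arc x x

module _ (G : Digraph) where
  open Digraph G

  V : Set
  V = Fin size

  StronglyConnected : Set
  StronglyConnected = ∀ x y → Star Arc x y

  Tuple : ℕ → Set
  Tuple n = Fin n → V

  ArcPow : (n : ℕ) → Tuple n → Tuple n → Set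
  ArcPow n xs ys = ∀ i → Arc (xs i) (ys i)

  IsPolymorphism : (n : ℕ) → (Tuple n → V) → Set
  IsPolymorphism n f = ∀ xs ys → ArcPow n xs ys → Arc (f xs) (f ys)

  IsIdempotent : (n : ℕ) → (Tuple n → V) → Set
  IsIdempotent n f = ∀ x → f (λ _ → x) ≡ x

  IsProjection : (n : ℕ) → (Tuple n → V) → Set
  IsProjection n f = ∃ λ (i : Fin n) → ∀ xs → f xs ≡ xs i

  IsEndo : (V → V) → Set
  IsEndo g = ∀ x y → Arc x y → Arc (g x) (g y)

  Endo : Set
  Endo = Σ (V → V) IsEndo

  IsEssentiallyUnary : (n : ℕ) → (Tuple n → V) → Set
  IsEssentiallyUnary n f =
    ∃ λ (i : Fin n) → ∃ λ (g : Endo) → ∀ xs → f xs ≡ proj₁ g (xs i)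

  IdempotentTrivial : Set
  IdempotentTrivial = ∀ (k : ℕ) → k ≥ 2 → (f : Tuple k → V) →
    IsPolymorphism k f → IsIdempotent k f → IsProjection k f

  HomArc : Endo → Endo → Set
  HomArc (g , _) (h , _) = ∀ x y → Arc x y → Arc (g x) (h y)

  idEndo : Endo
  idEndo = (λ x → x) , (λ x y a → a)

  IdAloneInComponent : Set
  IdAloneInComponent = ∀ (h : Endo) → Star HomArc idEndo h → Star HomArc h idEndo →
    ∀ x → proj₁ h x ≡ x

  -- embedding G ↪ G^n: injective (tuples compared pointwise),
  -- homomorphism, and onto an induced subdigraph
  IsEmbedding : (n : ℕ) → (V → Tuple n) → Set
  IsEmbedding n e =
    (∀ x y → (∀ i → e x i ≡ e y i) → x ≡ y) ×
    (∀ x y → Arc x y → ArcPow n (e x) (e y)) ×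
    (∀ x y → ArcPow n (e x) (e y) → Arc x y)

  IsSurjective : (n : ℕ) → (Tuple n → V) → Set
  IsSurjective n f = ∀ v → ∃ λ xs → f xs ≡ v

-- Let r be a section of the surjection f ∘ e.  On a finite digraph f ∘ e is an
-- automorphism of finite order, so r is one of its powers and hence an
-- endomorphism, and the coordinates ρᵢ = πᵢ ∘ e ∘ r are endomorphisms with
-- f (ρ₁ y, …, ρₙ y) = y.  So f ∘ (ρ₁ × ⋯ × ρₙ) is an idempotent polymorphism,
-- i.e. the projection onto some coordinate k.  The endomorphisms
-- K_c = f (c with ρₖ y at k), c ∈ Gⁿ, form a family connected in Hom(G,G) since
-- Gⁿ is strongly connected, and for c in the image of ρ₁ × ⋯ × ρₙ the member K_c
-- is the identity; as the identity is alone in its component, every K_c is.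
-- For constant c this says u ∘ ρₖ = id with u the diagonal of f, so ρₖ and u are
-- mutually inverse by finiteness, ρₖ ∘ f is an idempotent polymorphism, say the
-- projection onto j, and f = u ∘ ρₖ ∘ f = u ∘ πⱼ.
module Submission where

open import Defs
open import Data.Nat using (ℕ; zero; suc; _+_; _*_; _∸_; _≥_)
open import Data.Nat.Properties using (n<1+n; m+[n∸m]≡n; +-suc; *-comm)
open import Data.Fin using (Fin; zero; suc; toℕ; _≟_)
open import Data.Fin.Properties using (pigeonhole)
open import Data.Product using (∃; _×_; _,_; proj₁; proj₂)
open import Data.Vec.Functional using (Vector; _∷_; head; tail; updateAt; _⊛_)
open import Data.Vec.Functional.Properties using (updateAt-updates; updateAt-minimal; updateAt-id-local)
open import Function using (_∘_; id; const)
open import Function.Definitions using (Injective)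
open import Relation.Binary.PropositionalEquality
  using (_≡_; _≗_; refl; sym; trans; cong; cong-app; subst; subst₂; module ≡-Reasoning)
open import Relation.Binary.Construct.Closure.ReflexiveTransitive using (Star; ε; _◅_; _◅◅_; gmap)
open import Relation.Nullary using (yes; no)

open ≡-Reasoning

module _ {A : Set} where
  open import Function.Endo.Propositional A using (_^_; ^-homo)

  ^-suc′ : ∀ (h : A → A) n x → (h ^ suc n) x ≡ (h ^ n) (h x)
  ^-suc′ h zero    x = refl
  ^-suc′ h (suc n) x = cong h (^-suc′ h n x)

  ^-+ : ∀ (h : A → A) m n x → (h ^ (m + n)) x ≡ (h ^ m) ((h ^ n) x)
  ^-+ h m n = cong-app (^-homo h m n)

  ^-fixed-* : ∀ (h : A → A) m p {x} → (h ^ p) x ≡ x → (h ^ (m * p)) x ≡ x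
  ^-fixed-* h zero    p hᵖx≡x = refl
  ^-fixed-* h (suc m) p hᵖx≡x =
    trans (^-+ h p (m * p) _) (trans (cong (h ^ p) (^-fixed-* h m p hᵖx≡x)) hᵖx≡x)

  ^-injective : ∀ {h : A → A} → Injective _≡_ _≡_ h → ∀ n → Injective _≡_ _≡_ (h ^ n)
  ^-injective h-inj zero    eq = eq
  ^-injective h-inj (suc n) eq = ^-injective h-inj n (h-inj eq)

  ^-section : ∀ (g r : A → A) → g ∘ r ≗ id → ∀ n → (g ^ n) ∘ (r ^ n) ≗ id
  ^-section g r gr zero    x = refl
  ^-section g r gr (suc n) x = begin
    g ((g ^ n) (r ((r ^ n) x)))  ≡⟨ ^-suc′ g n _ ⟩
    (g ^ n) (g (r ((r ^ n) x)))  ≡⟨ cong (g ^ n) (gr _) ⟩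
    (g ^ n) ((r ^ n) x)          ≡⟨ ^-section g r gr n x ⟩
    x                            ∎

  common-period : ∀ (h : A → A) → (∀ x → ∃ λ d → (h ^ suc d) x ≡ x) →
                  ∀ m (xs : Vector A m) → ∃ λ N → ∀ i → (h ^ suc N) (xs i) ≡ xs i
  common-period h per zero    xs = 0 , λ ()
  common-period h per (suc m) xs with per (head xs) | common-period h per m (tail xs)
  ... | d , hd | N , hN = N + d * suc N , λ where
    zero    → subst (λ p → (h ^ p) (head xs) ≡ head xs) (*-comm (suc N) (suc d))
                    (^-fixed-* h (suc N) (suc d) hd)
    (suc i) → ^-fixed-* h (suc d) (suc N) (hN i)

  section≗power : ∀ (g r : A → A) N → g ^ suc N ≗ id → g ∘ r ≗ id → r ≗ g ^ N
  section≗power g r N gᴺ⁺¹≗id gr x = begin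
    r x                  ≡⟨ sym (gᴺ⁺¹≗id (r x)) ⟩
    (g ^ suc N) (r x)    ≡⟨ ^-suc′ g N (r x) ⟩
    (g ^ N) (g (r x))    ≡⟨ cong (g ^ N) (gr x) ⟩
    (g ^ N) x            ∎

module _ {s : ℕ} where
  open import Function.Endo.Propositional (Fin s) using (_^_)

  injective⇒periodic : ∀ (h : Fin s → Fin s) → Injective _≡_ _≡_ h →
                       ∀ x → ∃ λ d → (h ^ suc d) x ≡ x
  injective⇒periodic h h-inj x with pigeonhole (n<1+n s) (λ i → (h ^ toℕ i) x)
  ... | i , j , i<j , hⁱx≡hʲx = d , sym (^-injective h-inj (toℕ i) (begin
      (h ^ toℕ i) x                ≡⟨ hⁱx≡hʲx ⟩
      (h ^ toℕ j) x                ≡⟨ cong (λ p → (h ^ p) x) (sym i+[d+1]≡j) ⟩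
      (h ^ (toℕ i + suc d)) x      ≡⟨ ^-+ h (toℕ i) (suc d) x ⟩
      (h ^ toℕ i) ((h ^ suc d) x)  ∎))
    where
    d : ℕ
    d = toℕ j ∸ suc (toℕ i)
    i+[d+1]≡j : toℕ i + suc d ≡ toℕ j
    i+[d+1]≡j = trans (+-suc (toℕ i) d) (m+[n∸m]≡n i<j)

  split-epi⇒finiteOrder : ∀ (g r : Fin s → Fin s) → g ∘ r ≗ id → ∃ λ N → g ^ suc N ≗ id
  split-epi⇒finiteOrder g r gr with common-period r (injective⇒periodic r r-inj) s id
    where
    r-inj : Injective _≡_ _≡_ r
    r-inj {a} {b} ra≡rb = trans (sym (gr a)) (trans (cong g ra≡rb) (gr b))
  ... | N , rᴺ⁺¹≗id = N , λ x → begin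
    (g ^ suc N) x                ≡⟨ cong (g ^ suc N) (sym (rᴺ⁺¹≗id x)) ⟩
    (g ^ suc N) ((r ^ suc N) x)  ≡⟨ ^-section g r gr (suc N) x ⟩
    x                            ∎

  section⇒retraction : ∀ (g r : Fin s → Fin s) → g ∘ r ≗ id → r ∘ g ≗ id
  section⇒retraction g r gr x with split-epi⇒finiteOrder g r gr
  ... | N , gᴺ⁺¹≗id = begin
    r (g x)            ≡⟨ section≗power g r N gᴺ⁺¹≗id gr (g x) ⟩
    (g ^ N) (g x)      ≡⟨ sym (^-suc′ g N x) ⟩
    (g ^ suc N) x      ≡⟨ gᴺ⁺¹≗id x ⟩
    x                  ∎

_[_]≔_ : ∀ {A : Set} {m} → Vector A m → Fin m → A → Vector A m
xs [ k ]≔ a = updateAt xs k (const a)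

[]≔-pointwise : ∀ {A : Set} {m} (R : A → A → Set) {xs ys : Vector A m} {a b} k →
                (∀ i → R (xs i) (ys i)) → R a b → ∀ i → R ((xs [ k ]≔ a) i) ((ys [ k ]≔ b) i)
[]≔-pointwise R {xs} {ys} k xRy aRb i with i ≟ k
... | yes refl = subst₂ R (sym (updateAt-updates i xs)) (sym (updateAt-updates i ys)) aRb
... | no  i≢k  = subst₂ R (sym (updateAt-minimal i k xs i≢k)) (sym (updateAt-minimal i k ys i≢k)) (xRy i)

⊛-[]≔ : ∀ {A B : Set} {m} (φ : Vector (A → B) m) xs k a → (φ ⊛ (xs [ k ]≔ a)) ≗ ((φ ⊛ xs) [ k ]≔ φ k a)
⊛-[]≔ φ xs k a i with i ≟ k
... | yes refl = trans (cong (φ i) (updateAt-updates i xs)) (sym (updateAt-updates i (φ ⊛ xs)))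
... | no  i≢k  = trans (cong (φ i) (updateAt-minimal i k xs i≢k)) (sym (updateAt-minimal i k (φ ⊛ xs) i≢k))

module _ (G : Digraph) where
  open Digraph G renaming (refl to arc-refl)
  open import Function.Endo.Propositional (V G) using (_^_)

  ^-isEndo : ∀ {g} → IsEndo G g → ∀ n → IsEndo G (g ^ n)
  ^-isEndo g-endo zero    x y xy = xy
  ^-isEndo g-endo (suc n) x y xy = g-endo _ _ (^-isEndo g-endo n x y xy)

  section-isEndo : ∀ (g r : V G → V G) → IsEndo G g → g ∘ r ≗ id → IsEndo G r
  section-isEndo g r g-endo gr x y xy with split-epi⇒finiteOrder g r gr
  ... | N , gᴺ⁺¹≗id = subst₂ Arc (sym (r≗gᴺ x)) (sym (r≗gᴺ y)) (^-isEndo g-endo N x y xy)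
    where
    r≗gᴺ : r ≗ g ^ N
    r≗gᴺ = section≗power g r N gᴺ⁺¹≗id gr

  ArcPow-refl : ∀ {m} (xs : Tuple G m) → ArcPow G m xs xs
  ArcPow-refl xs i = arc-refl (xs i)

  power-stronglyConnected : StronglyConnected G → ∀ m (xs ys : Tuple G m) → Star (ArcPow G m) xs ys
  power-stronglyConnected sc zero    xs ys = (λ ()) ◅ ε
  power-stronglyConnected sc (suc m) xs ys =
    η xs ◅ gmap (_∷ tail xs) (λ ab → ∷-arc ab (ArcPow-refl (tail xs))) (sc (head xs) (head ys))
      ◅◅ gmap (head ys ∷_) (∷-arc (arc-refl (head ys))) (power-stronglyConnected sc m (tail xs) (tail ys))
      ◅◅ η⁻ ys ◅ ε
    where
    ∷-arc : ∀ {a b} {zs zs′ : Tuple G m} → Arc a b → ArcPow G m zs zs′ →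
            ArcPow G (suc m) (a ∷ zs) (b ∷ zs′)
    ∷-arc ab _  zero    = ab
    ∷-arc _  zz (suc i) = zz i
    η : ∀ zs → ArcPow G (suc m) zs (head zs ∷ tail zs)
    η zs zero    = arc-refl _
    η zs (suc i) = arc-refl _
    η⁻ : ∀ zs → ArcPow G (suc m) (head zs ∷ tail zs) zs
    η⁻ zs zero    = arc-refl _
    η⁻ zs (suc i) = arc-refl _

  module _ (alone : IdAloneInComponent G) where

    connected-family-≗id : ∀ {I : Set} {R : I → I → Set} → (∀ i j → Star R i j) →
                           (K : I → Endo G) → (∀ {i j} → R i j → HomArc G (K i) (K j)) →
                           ∀ {i₀} → proj₁ (K i₀) ≗ id → ∀ i → proj₁ (K i) ≗ id
    connected-family-≗id connected K K-mono {i₀} K₀≗id i =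
      alone (K i) (from-id ◅ gmap K K-mono (connected i₀ i))
                  (gmap K K-mono (connected i i₀) ◅◅ to-id ◅ ε)
      where
      from-id : HomArc G (idEndo G) (K i₀)
      from-id x y xy = subst (λ z → Arc z _) (K₀≗id x) (proj₂ (K i₀) x y xy)
      to-id : HomArc G (K i₀) (idEndo G)
      to-id x y xy = subst (Arc _) (K₀≗id y) (proj₂ (K i₀) x y xy)

    -- Without function extensionality f need not respect ≗ on tuples; instead
    -- f ∘ T′ is linked both ways in Hom(G,G) to f ∘ T ≗ id.
    section-resp-≗ : ∀ {m} {f : Tuple G m → V G} → IsPolymorphism G m f →
                     (T T′ : V G → Tuple G m) → (∀ x → T x ≗ T′ x) →
                     (∀ x y → Arc x y → ArcPow G m (T′ x) (T′ y)) →
                     f ∘ T ≗ id → f ∘ T′ ≗ id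
    section-resp-≗ {f = f} f-poly T T′ T≗T′ T′-hom fT≗id =
      alone fT′ (from-id ◅ ε) (to-id ◅ ε)
      where
      fT′ : Endo G
      fT′ = f ∘ T′ , λ x y xy → f-poly _ _ (T′-hom x y xy)
      from-id : HomArc G (idEndo G) fT′
      from-id x y xy = subst (λ z → Arc z _) (fT≗id x) (f-poly _ _ λ i →
        subst (λ z → Arc z _) (sym (T≗T′ x i)) (T′-hom x y xy i))
      to-id : HomArc G fT′ (idEndo G)
      to-id x y xy = subst (Arc _) (fT≗id y) (f-poly _ _ λ i →
        subst (Arc _) (sym (T≗T′ y i)) (T′-hom x y xy i))

  module EssentialUnarity
      (sc : StronglyConnected G) (n : ℕ) (n≥2 : n ≥ 2)
      (f : Tuple G n → V G) (f-poly : IsPolymorphism G n f)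
      (idem-trivial : IdempotentTrivial G) (alone : IdAloneInComponent G)
      (e : V G → Tuple G n) (e-hom : ∀ x y → Arc x y → ArcPow G n (e x) (e y))
      (f∘e-onto : ∀ v → ∃ λ x → f (e x) ≡ v) where

    r : V G → V G
    r v = proj₁ (f∘e-onto v)

    f∘e∘r≗id : f ∘ e ∘ r ≗ id
    f∘e∘r≗id v = proj₂ (f∘e-onto v)

    r-isEndo : IsEndo G r
    r-isEndo = section-isEndo (f ∘ e) r (λ x y xy → f-poly _ _ (e-hom x y xy)) f∘e∘r≗id

    ρ : Fin n → V G → V G
    ρ i y = e (r y) i

    ρ-hom : ∀ i x y → Arc x y → Arc (ρ i x) (ρ i y)
    ρ-hom i x y xy = e-hom (r x) (r y) (r-isEndo x y xy) i

    f∘ρ⊛-isProjection : IsProjection G n (λ xs → f (ρ ⊛ xs))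
    f∘ρ⊛-isProjection =
      idem-trivial n n≥2 _ (λ xs ys xy → f-poly _ _ λ i → ρ-hom i _ _ (xy i)) f∘e∘r≗id

    u : V G → V G
    u x = f (const x)

    u-isEndo : IsEndo G u
    u-isEndo x y xy = f-poly _ _ (λ _ → xy)

    module _ (k : Fin n) (f∘ρ⊛≡πₖ : ∀ xs → f (ρ ⊛ xs) ≡ xs k) where

      K : Tuple G n → Endo G
      K c = (λ y → f (c [ k ]≔ ρ k y))
          , (λ x y xy → f-poly _ _ ([]≔-pointwise Arc k (ArcPow-refl c) (ρ-hom k x y xy)))

      K-mono : ∀ {c c′} → ArcPow G n c c′ → HomArc G (K c) (K c′)
      K-mono cc′ x y xy = f-poly _ _ ([]≔-pointwise Arc k cc′ (ρ-hom k x y xy))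

      K-ρ⊛-≗id : ∀ c → proj₁ (K (ρ ⊛ c)) ≗ id
      K-ρ⊛-≗id c =
        section-resp-≗ alone f-poly (λ x → ρ ⊛ (c [ k ]≔ x)) (λ x → (ρ ⊛ c) [ k ]≔ ρ k x)
          (⊛-[]≔ ρ c k) (λ x y xy → []≔-pointwise Arc k (ArcPow-refl _) (ρ-hom k x y xy))
          (λ x → trans (f∘ρ⊛≡πₖ _) (updateAt-updates k c))

      K-≗id : ∀ c → proj₁ (K c) ≗ id
      K-≗id c = connected-family-≗id alone (power-stronglyConnected sc n) K K-mono (K-ρ⊛-≗id c) c

      u∘ρₖ≗id : u ∘ ρ k ≗ id
      u∘ρₖ≗id =
        section-resp-≗ alone f-poly (λ x → const (ρ k x) [ k ]≔ ρ k x) (const ∘ ρ k)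
          (λ x → updateAt-id-local k (const (ρ k x)) refl) (λ x y xy _ → ρ-hom k x y xy)
          (λ x → K-≗id (const (ρ k x)) x)

      ρₖ∘f-isProjection : IsProjection G n (ρ k ∘ f)
      ρₖ∘f-isProjection = idem-trivial n n≥2 _ (λ xs ys xy → ρ-hom k _ _ (f-poly xs ys xy))
                                               (section⇒retraction u (ρ k) u∘ρₖ≗id)

      f-essentiallyUnary : IsEssentiallyUnary G n f
      f-essentiallyUnary =
        let j , ρₖ∘f≡πⱼ = ρₖ∘f-isProjection in
        j , (u , u-isEndo) , λ xs → begin
          f xs             ≡⟨ sym (u∘ρₖ≗id (f xs)) ⟩
          u (ρ k (f xs))   ≡⟨ cong u (ρₖ∘f≡πⱼ xs) ⟩
          u (xs j)         ∎

lemma3p5 : (G : Digraph) → StronglyConnected G → (n : ℕ) → n ≥ 2 →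
    (f : Tuple G n → V G) → IsPolymorphism G n f → IsSurjective G n f →
    IdempotentTrivial G → IdAloneInComponent G →
    (∃ λ (e : V G → Tuple G n) → IsEmbedding G n e × (∀ v → ∃ λ x → f (e x) ≡ v)) →
    IsEssentiallyUnary G n f
lemma3p5 G sc n n≥2 f f-poly _ idem-trivial alone (e , (_ , e-hom , _) , f∘e-onto) =
  let k , f∘ρ⊛≡πₖ = f∘ρ⊛-isProjection in f-essentiallyUnary k f∘ρ⊛≡πₖ
  where open EssentialUnarity G sc n n≥2 f f-poly idem-trivial alone e e-hom f∘e-onto
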